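{- Let $n$ and $r$ be positive integers, let $L\subset\mathbb{N}$ be a set with $|L|=s\geq 1$, and let $\mathcal{F}$ be an $L$-intersecting, $n$-uniform set family. Let $m=\max\{r-1,\,n^2-n+1\}$. If \[|\mathcal{F}|> 2^{\,n\log_2(s+1)+s\log_2(m)},\] then $\mathcal{F}$ contains an $r$-sunflower.
   Context: A set family over a finite set $X$ is a collection of subsets of $X$; it is $n$-uniform if every member has exactly $n$ elements. For $L\subset\mathbb{N}$ (here $\mathbb{N}$ includes $0$), a family $\mathcal{F}$ is $L$-intersecting if $|F_i\cap F_j|\in L$ for all distinct $F_i,F_j\in\mathcal{F}$. An $r$-sunflower is a collection of $r$ distinct sets $S_1,\dots,S_r$ such that $S_i\cap S_j=S_1\cap S_2\cap\cdots\cap S_r$ for all $i\neq j$. "$\mathcal{F}$ contains an $r$-sunflower" means some $r$ distinct members of $\mathcal{F}$ form an $r$-sunflower. -}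

module Defs where

open import Data.Nat using (ℕ; _+_; _*_; _^_; _∸_; _⊔_)
open import Data.Fin using (Fin)
open import Data.Fin.Subset using (Subset; _∩_; ⋂; ∣_∣)
open import Data.List using (List; tabulate)
open import Data.List.Membership.Propositional using (_∈_)
open import Function.Definitions using (Injective)
open import Relation.Binary.PropositionalEquality using (_≡_; _≢_)
open import Data.Product using (Σ; _×_)

-- A set family over the finite ground set X = Fin N is a list of subsets;
-- its members are the elements of the list (distinctness imposed separately).

Uniform : {N : ℕ} → ℕ → List (Subset N) → Set
Uniform n F = ∀ A → A ∈ F → ∣ A ∣ ≡ n

LIntersecting : {N : ℕ} → List ℕ → List (Subset N) → Set
LIntersecting L F = ∀ A B → A ∈ F → B ∈ F → A ≢ B → ∣ A ∩ B ∣ ∈ L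

IsSunflower : {N : ℕ} (r : ℕ) → (Fin r → Subset N) → Set
IsSunflower r S =
  Injective _≡_ _≡_ S ×
  (∀ i j → i ≢ j → S i ∩ S j ≡ ⋂ (tabulate S))

ContainsSunflower : {N : ℕ} → ℕ → List (Subset N) → Set
ContainsSunflower {N} r F =
  Σ (Fin r → Subset N) λ S → (∀ i → S i ∈ F) × IsSunflower r S

mBound : ℕ → ℕ → ℕ
mBound n r = (r ∸ 1) ⊔ (n * n ∸ n + 1)

-- 2^(n log₂(s+1) + s log₂ m) = (s+1)^n · m^s
sizeBound : ℕ → ℕ → ℕ → ℕ
sizeBound n s m = (s + 1) ^ n * m ^ s

-- Write s = |L| and m = mBound n r; only m ≥ 1 and m ≥ r − 1 are used. Call k the kernel of a family
-- whose members all contain k and have exactly d further elements. If |k| ∈ L, then |F| ≤ m^s s^d or F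
-- contains an r-sunflower, by induction on d: choose greedily a maximal list D of petals pairwise meeting
-- exactly in k. Either |D| ≥ r and D is a sunflower, or |D| ≤ m and every member b meets some petal a in
-- a trace t = b ∩ a ⊋ k. The members with trace t on a form a family with kernel t and d' = |a ─ t| < d,
-- whose pairwise intersections contain t and so have sizes in the shorter list L′ of sizes > |k|.
-- Summing the inductive bound over k ⊆ t ⊆ a with Σ x^|a ─ t| = (1 + x)^|a ─ k| gives m^(s−1) s^d per
-- petal. For the theorem itself |∅| need not lie in L, so F is grouped around a single member instead,
-- which costs the factor (s + 1)^n.
module Submission where

open import Data.Bool.Base using (true; false)
open import Data.Bool.Properties using () renaming (_≟_ to _≟ᵇ_)
open import Data.Fin.Base using (Fin; zero; suc; inject≤)
open import Data.Fin.Properties using (inject≤-injective) renaming (_≟_ to _≟ᶠ_)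
open import Data.Fin.Subset using (Subset; _⊆_; _∩_; _─_; ⋂; ∣_∣; ⊥)
open import Data.Fin.Subset.Properties
  using ( drop-∷-⊆; s⊆s; out⊆; ⊆-refl; ⊆-trans; ⊆-antisym; ⊆-min; ⊆-max
        ; p∩q⊆p; p∩q⊆q; x∈p∩q⁺; ∩-idem; ∩-comm; p⊆q⇒∣p∣≤∣q∣; p─⊥≡p )
open import Data.List.Base using (List; []; _∷_; _++_; map; filter; length; lookup; tabulate)
open import Data.List.Membership.Propositional using (_∈_)
open import Data.List.Membership.Propositional.Properties
  using (∈-map⁺; ∈-map⁻; ∈-++⁺ˡ; ∈-++⁺ʳ; ∈-++⁻; ∈-filter⁺; ∈-filter⁻; ∈-lookup; ∈-tabulate⁺; ∈-tabulate⁻)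
open import Data.List.Properties using (map-++; map-∘; filter-accept; filter-notAll; filter-none)
open import Data.List.Relation.Binary.Subset.Propositional using () renaming (_⊆_ to _⊆ₗ_)
open import Data.List.Relation.Binary.Subset.Propositional.Properties using (filter-⊆)
open import Data.List.Relation.Unary.All as All using (all?)
open import Data.List.Relation.Unary.All.Properties using (¬All⇒Any¬)
open import Data.List.Relation.Unary.AllPairs using (AllPairs; []; _∷_)
open import Data.List.Relation.Unary.Any as Any using (Any; here; there)
open import Data.List.Relation.Unary.Unique.Propositional using (Unique)
open import Data.List.Relation.Unary.Unique.Propositional.Properties using (Unique[x∷xs]⇒x∉xs)
  renaming (filter⁺ to Unique-filter⁺)
open import Data.Nat.Base using (ℕ; zero; suc; _+_; _*_; _∸_; _^_; _≤_; _<_; z≤n; s≤s; NonZero; >-nonZero)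
open import Data.Nat.Induction using (<-wellFounded)
open import Data.Nat.ListAction using (sum)
open import Data.Nat.ListAction.Properties using (sum-++)
open import Data.Nat.Properties
open import Data.Product.Base using (_×_; _,_; proj₁; proj₂; uncurry)
open import Data.Sum.Base using (_⊎_; inj₁; inj₂; map₁; map₂)
open import Data.Vec.Base as Vec using ([]; _∷_)
open import Data.Vec.Properties using (≡-dec)
open import Function.Base using (_∘_; case_of_)
open import Induction.WellFounded using (Acc; acc)
open import Relation.Binary.Definitions using (DecidableEquality; Symmetric)
open import Relation.Binary.PropositionalEquality
open import Relation.Nullary using (¬?; yes; no; contradiction)
open import Relation.Unary using (Decidable)

open import Defs

infix 4 _≟ˢ_
_≟ˢ_ : ∀ {n} → DecidableEquality (Subset n)
_≟ˢ_ = ≡-dec _≟ᵇ_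

⊆-∩ : ∀ {n} {p q r : Subset n} → p ⊆ q → p ⊆ r → p ⊆ q ∩ r
⊆-∩ p⊆q p⊆r x∈p = x∈p∩q⁺ (p⊆q x∈p , p⊆r x∈p)

⋂-⊆ : ∀ {n} {p : Subset n} {ps} → p ∈ ps → ⋂ ps ⊆ p
⋂-⊆ {ps = q ∷ ps} (here refl) = p∩q⊆p q (⋂ ps)
⋂-⊆ {ps = q ∷ ps} (there p∈ps) = ⊆-trans (p∩q⊆q q (⋂ ps)) (⋂-⊆ p∈ps)

⊆-⋂ : ∀ {n} {p : Subset n} ps → (∀ {q} → q ∈ ps → p ⊆ q) → p ⊆ ⋂ ps
⊆-⋂ []       _     = ⊆-max _
⊆-⋂ (q ∷ ps) p⊆ps = ⊆-∩ (p⊆ps (here refl)) (⊆-⋂ ps (p⊆ps ∘ there))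

∣p∣≡∣q∣+∣p─q∣ : ∀ {n} {p q : Subset n} → q ⊆ p → ∣ p ∣ ≡ ∣ q ∣ + ∣ p ─ q ∣
∣p∣≡∣q∣+∣p─q∣ {p = []}        {[]}        _   = refl
∣p∣≡∣q∣+∣p─q∣ {p = true ∷ p}  {true ∷ q}  q⊆p = cong suc (∣p∣≡∣q∣+∣p─q∣ (drop-∷-⊆ q⊆p))
∣p∣≡∣q∣+∣p─q∣ {p = true ∷ p}  {false ∷ q} q⊆p =
  trans (cong suc (∣p∣≡∣q∣+∣p─q∣ (drop-∷-⊆ q⊆p))) (sym (+-suc _ _))
∣p∣≡∣q∣+∣p─q∣ {p = false ∷ p} {false ∷ q} q⊆p = ∣p∣≡∣q∣+∣p─q∣ (drop-∷-⊆ q⊆p)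
∣p∣≡∣q∣+∣p─q∣ {p = false ∷ p} {true ∷ q}  q⊆p with () ← q⊆p Vec.here

∣p─q∣≡0⇒p≡q : ∀ {n} {p q : Subset n} → q ⊆ p → ∣ p ─ q ∣ ≡ 0 → p ≡ q
∣p─q∣≡0⇒p≡q {p = []}        {[]}        _   _ = refl
∣p─q∣≡0⇒p≡q {p = true ∷ p}  {true ∷ q}  q⊆p e = cong (true ∷_) (∣p─q∣≡0⇒p≡q (drop-∷-⊆ q⊆p) e)
∣p─q∣≡0⇒p≡q {p = false ∷ p} {false ∷ q} q⊆p e = cong (false ∷_) (∣p─q∣≡0⇒p≡q (drop-∷-⊆ q⊆p) e)
∣p─q∣≡0⇒p≡q {p = false ∷ p} {true ∷ q}  q⊆p _ with () ← q⊆p Vec.here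

∣p─p∣≡0 : ∀ {n} (p : Subset n) → ∣ p ─ p ∣ ≡ 0
∣p─p∣≡0 []          = refl
∣p─p∣≡0 (true ∷ p)  = ∣p─p∣≡0 p
∣p─p∣≡0 (false ∷ p) = ∣p─p∣≡0 p

q⊂p⇒∣q∣<∣p∣ : ∀ {n} {p q : Subset n} → q ⊆ p → p ≢ q → ∣ q ∣ < ∣ p ∣
q⊂p⇒∣q∣<∣p∣ {p = p} {q} q⊆p p≢q = begin-strict
  ∣ q ∣             <⟨ m<m+n ∣ q ∣ (n≢0⇒n>0 (p≢q ∘ ∣p─q∣≡0⇒p≡q q⊆p)) ⟩
  ∣ q ∣ + ∣ p ─ q ∣ ≡⟨ ∣p∣≡∣q∣+∣p─q∣ q⊆p ⟨
  ∣ p ∣             ∎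
  where open ≤-Reasoning

∣p─q∣≡∣p─r∣+∣r─q∣ : ∀ {n} {p q r : Subset n} → q ⊆ r → r ⊆ p → ∣ p ─ q ∣ ≡ ∣ p ─ r ∣ + ∣ r ─ q ∣
∣p─q∣≡∣p─r∣+∣r─q∣ {p = p} {q} {r} q⊆r r⊆p = +-cancelˡ-≡ ∣ q ∣ _ _ (begin
  ∣ q ∣ + ∣ p ─ q ∣               ≡⟨ ∣p∣≡∣q∣+∣p─q∣ (⊆-trans q⊆r r⊆p) ⟨
  ∣ p ∣                           ≡⟨ ∣p∣≡∣q∣+∣p─q∣ r⊆p ⟩
  ∣ r ∣ + ∣ p ─ r ∣               ≡⟨ cong (_+ ∣ p ─ r ∣) (∣p∣≡∣q∣+∣p─q∣ q⊆r) ⟩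
  ∣ q ∣ + ∣ r ─ q ∣ + ∣ p ─ r ∣   ≡⟨ +-assoc ∣ q ∣ _ _ ⟩
  ∣ q ∣ + (∣ r ─ q ∣ + ∣ p ─ r ∣) ≡⟨ cong (∣ q ∣ +_) (+-comm ∣ r ─ q ∣ _) ⟩
  ∣ q ∣ + (∣ p ─ r ∣ + ∣ r ─ q ∣) ∎)
  where open ≡-Reasoning

∣b─b∩a∣≡∣a─b∩a∣ : ∀ {n} {k a b : Subset n} → k ⊆ a → k ⊆ b → ∣ a ─ k ∣ ≡ ∣ b ─ k ∣ →
                  ∣ b ─ b ∩ a ∣ ≡ ∣ a ─ b ∩ a ∣
∣b─b∩a∣≡∣a─b∩a∣ {k = k} {a} {b} k⊆a k⊆b eq = +-cancelʳ-≡ ∣ b ∩ a ─ k ∣ _ _ (begin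
  ∣ b ─ b ∩ a ∣ + ∣ b ∩ a ─ k ∣ ≡⟨ ∣p─q∣≡∣p─r∣+∣r─q∣ k⊆b∩a (p∩q⊆p b a) ⟨
  ∣ b ─ k ∣                     ≡⟨ eq ⟨
  ∣ a ─ k ∣                     ≡⟨ ∣p─q∣≡∣p─r∣+∣r─q∣ k⊆b∩a (p∩q⊆q b a) ⟩
  ∣ a ─ b ∩ a ∣ + ∣ b ∩ a ─ k ∣ ∎)
  where
  open ≡-Reasoning
  k⊆b∩a = ⊆-∩ k⊆b k⊆a

module _ {A : Set} where

  sum-map-*ˡ : ∀ c (f : A → ℕ) xs → sum (map (λ x → c * f x) xs) ≡ c * sum (map f xs)
  sum-map-*ˡ c f []       = sym (*-zeroʳ c)
  sum-map-*ˡ c f (x ∷ xs) = trans (cong (c * f x +_) (sum-map-*ˡ c f xs)) (sym (*-distribˡ-+ c (f x) _))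

  sum-map-const : ∀ c (xs : List A) → sum (map (λ _ → c) xs) ≡ length xs * c
  sum-map-const c []       = refl
  sum-map-const c (x ∷ xs) = cong (c +_) (sum-map-const c xs)

  sum-map-mono : ∀ {f g : A → ℕ} xs → (∀ {x} → x ∈ xs → f x ≤ g x) → sum (map f xs) ≤ sum (map g xs)
  sum-map-mono []       _   = z≤n
  sum-map-mono (x ∷ xs) f≤g = +-mono-≤ (f≤g (here refl)) (sum-map-mono xs (f≤g ∘ there))

  sum-map-< : ∀ {f g : A → ℕ} {xs} → (∀ x → f x ≤ g x) → Any (λ x → f x < g x) xs →
              sum (map f xs) < sum (map g xs)
  sum-map-< {xs = _ ∷ xs} f≤g (here fx<gx) = +-mono-<-≤ fx<gx (sum-map-mono xs (λ {y} _ → f≤g y))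
  sum-map-< {xs = x ∷ _}  f≤g (there any<) = +-mono-≤-< (f≤g x) (sum-map-< f≤g any<)

  sequence-⊎ : ∀ {S : Set} {Q : A → Set} xs → (∀ {x} → x ∈ xs → S ⊎ Q x) → S ⊎ (∀ {x} → x ∈ xs → Q x)
  sequence-⊎ []       _ = inj₂ λ ()
  sequence-⊎ (x ∷ xs) h with h (here refl) | sequence-⊎ xs (h ∘ there)
  ... | inj₁ s  | _       = inj₁ s
  ... | inj₂ _  | inj₁ s  = inj₁ s
  ... | inj₂ qx | inj₂ qs = inj₂ λ { (here refl) → qx ; (there x∈xs) → qs x∈xs }

  Unique-const⇒length≤1 : ∀ {k} {xs : List A} → Unique xs → (∀ {x} → x ∈ xs → x ≡ k) → length xs ≤ 1
  Unique-const⇒length≤1 {xs = []}        _ _     = z≤n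
  Unique-const⇒length≤1 {xs = _ ∷ []}    _ _     = ≤-refl
  Unique-const⇒length≤1 {xs = x ∷ y ∷ _} u all≡k =
    contradiction (here (trans (all≡k (here refl)) (sym (all≡k (there (here refl))))))
                  (Unique[x∷xs]⇒x∉xs u)

module _ {X I : Set} {P : I → X → Set} (P? : ∀ i → Decidable (P i)) where

  length-filter-∷-≤ : ∀ i x xs → length (filter (P? i) xs) ≤ length (filter (P? i) (x ∷ xs))
  length-filter-∷-≤ i x xs with P? i x
  ... | yes _ = n≤1+n _
  ... | no  _ = ≤-refl

  length≤sum-length-filter : ∀ is xs → (∀ {x} → x ∈ xs → Any (λ i → P i x) is) →
                             length xs ≤ sum (map (λ i → length (filter (P? i) xs)) is)
  length≤sum-length-filter is []       _     = z≤n
  length≤sum-length-filter is (x ∷ xs) cover =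
    ≤-<-trans (length≤sum-length-filter is xs (cover ∘ there))
      (sum-map-< (λ i → length-filter-∷-≤ i x xs)
        (Any.map (λ pix → ≤-reflexive (cong length (sym (filter-accept (P? _) pix)))) (cover (here refl))))

interval : ∀ {n} → Subset n → Subset n → List (Subset n)
interval []          []          = [] ∷ []
interval (true ∷ k)  (_ ∷ a)     = map (true ∷_) (interval k a)
interval (false ∷ k) (true ∷ a)  = map (false ∷_) (interval k a) ++ map (true ∷_) (interval k a)
interval (false ∷ k) (false ∷ a) = map (false ∷_) (interval k a)

∈-interval : ∀ {n} {k t a : Subset n} → k ⊆ t → t ⊆ a → t ∈ interval k a
∈-interval {k = []}        {[]}        {[]}        _   _   = here refl
∈-interval {k = true ∷ k}  {true ∷ t}  {_ ∷ a}     k⊆t t⊆a =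
  ∈-map⁺ _ (∈-interval (drop-∷-⊆ k⊆t) (drop-∷-⊆ t⊆a))
∈-interval {k = false ∷ k} {false ∷ t} {true ∷ a}  k⊆t t⊆a =
  ∈-++⁺ˡ (∈-map⁺ _ (∈-interval (drop-∷-⊆ k⊆t) (drop-∷-⊆ t⊆a)))
∈-interval {k = false ∷ k} {false ∷ t} {false ∷ a} k⊆t t⊆a =
  ∈-map⁺ _ (∈-interval (drop-∷-⊆ k⊆t) (drop-∷-⊆ t⊆a))
∈-interval {k = false ∷ k} {true ∷ t}  {true ∷ a}  k⊆t t⊆a =
  ∈-++⁺ʳ _ (∈-map⁺ _ (∈-interval (drop-∷-⊆ k⊆t) (drop-∷-⊆ t⊆a)))
∈-interval {k = true ∷ k}  {false ∷ t} k⊆t _ with () ← k⊆t Vec.here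
∈-interval {k = false ∷ k} {true ∷ t}  {false ∷ a} _ t⊆a with () ← t⊆a Vec.here

∈-interval⁻ : ∀ {n} {k t a : Subset n} → k ⊆ a → t ∈ interval k a → k ⊆ t × t ⊆ a
∈-interval⁻ {k = []} {a = []} _ (here refl) = ⊆-refl , ⊆-refl
∈-interval⁻ {k = true ∷ k} {a = true ∷ a} k⊆a t∈
  with t′ , t′∈ , refl ← ∈-map⁻ (true ∷_) t∈
  with k⊆t′ , t′⊆a ← ∈-interval⁻ (drop-∷-⊆ k⊆a) t′∈ = s⊆s k⊆t′ , s⊆s t′⊆a
∈-interval⁻ {k = false ∷ k} {a = true ∷ a} k⊆a t∈ with ∈-++⁻ (map (false ∷_) (interval k a)) t∈
... | inj₁ t∈ˡ with t′ , t′∈ , refl ← ∈-map⁻ (false ∷_) t∈ˡ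
  with k⊆t′ , t′⊆a ← ∈-interval⁻ (drop-∷-⊆ k⊆a) t′∈ = out⊆ k⊆t′ , out⊆ t′⊆a
... | inj₂ t∈ʳ with t′ , t′∈ , refl ← ∈-map⁻ (true ∷_) t∈ʳ
  with k⊆t′ , t′⊆a ← ∈-interval⁻ (drop-∷-⊆ k⊆a) t′∈ = out⊆ k⊆t′ , s⊆s t′⊆a
∈-interval⁻ {k = false ∷ k} {a = false ∷ a} k⊆a t∈
  with t′ , t′∈ , refl ← ∈-map⁻ (false ∷_) t∈
  with k⊆t′ , t′⊆a ← ∈-interval⁻ (drop-∷-⊆ k⊆a) t′∈ = out⊆ k⊆t′ , out⊆ t′⊆a
∈-interval⁻ {k = true ∷ k} {a = false ∷ a} k⊆a _ with () ← k⊆a Vec.here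

sum-interval : ∀ {n} x {k a : Subset n} → k ⊆ a →
               sum (map (λ t → x ^ ∣ a ─ t ∣) (interval k a)) ≡ suc x ^ ∣ a ─ k ∣
sum-interval x {[]}        {[]}        _   = refl
sum-interval x {true ∷ k}  {true ∷ a}  k⊆a =
  trans (cong sum (sym (map-∘ (interval k a)))) (sum-interval x (drop-∷-⊆ k⊆a))
sum-interval x {false ∷ k} {false ∷ a} k⊆a =
  trans (cong sum (sym (map-∘ (interval k a)))) (sum-interval x (drop-∷-⊆ k⊆a))
sum-interval x {false ∷ k} {true ∷ a}  k⊆a = begin
  sum (map f (map (false ∷_) I ++ map (true ∷_) I))
    ≡⟨ cong sum (map-++ f (map (false ∷_) I) _) ⟩
  sum (map f (map (false ∷_) I) ++ map f (map (true ∷_) I))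
    ≡⟨ sum-++ (map f (map (false ∷_) I)) _ ⟩
  sum (map f (map (false ∷_) I)) + sum (map f (map (true ∷_) I))
    ≡⟨ cong₂ _+_ (cong sum (sym (map-∘ I))) (cong sum (sym (map-∘ I))) ⟩
  sum (map (λ t → x * x ^ ∣ a ─ t ∣) I) + Σ
    ≡⟨ cong (_+ Σ) (sum-map-*ˡ x (λ t → x ^ ∣ a ─ t ∣) I) ⟩
  x * Σ + Σ
    ≡⟨ cong (λ y → x * y + y) (sum-interval x (drop-∷-⊆ k⊆a)) ⟩
  x * suc x ^ ∣ a ─ k ∣ + suc x ^ ∣ a ─ k ∣
    ≡⟨ +-comm (x * suc x ^ ∣ a ─ k ∣) _ ⟩
  suc x ^ suc ∣ a ─ k ∣ ∎
  where
  open ≡-Reasoning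
  I = interval k a
  f = λ t → x ^ ∣ (true ∷ a) ─ t ∣
  Σ = sum (map (λ t → x ^ ∣ a ─ t ∣) I)
sum-interval x {true ∷ k}  {false ∷ a} k⊆a with () ← k⊆a Vec.here

length-bound-by-traces : ∀ {n} {S : Set} {k a : Subset n} (c x : ℕ) → k ⊆ a →
  (G : List (Subset n)) → (∀ {b} → b ∈ G → k ⊆ b) →
  (∀ {t} → k ⊆ t → t ⊆ a → S ⊎ length (filter (λ b → b ∩ a ≟ˢ t) G) ≤ c * x ^ ∣ a ─ t ∣) →
  S ⊎ length G ≤ c * suc x ^ ∣ a ─ k ∣
length-bound-by-traces {k = k} {a} c x k⊆a G k⊆G trace-bound
  with sequence-⊎ (interval k a) (λ t∈ → uncurry trace-bound (∈-interval⁻ k⊆a t∈))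
... | inj₁ s      = inj₁ s
... | inj₂ bounds = inj₂ (begin
  length G
    ≤⟨ length≤sum-length-filter (λ t b → b ∩ a ≟ˢ t) I G
         (λ {b} b∈G → ∈-interval (⊆-∩ (k⊆G b∈G) k⊆a) (p∩q⊆q b a)) ⟩
  sum (map (λ t → length (filter (λ b → b ∩ a ≟ˢ t) G)) I)
    ≤⟨ sum-map-mono I bounds ⟩
  sum (map (λ t → c * x ^ ∣ a ─ t ∣) I)
    ≡⟨ sum-map-*ˡ c _ I ⟩
  c * sum (map (λ t → x ^ ∣ a ─ t ∣) I)
    ≡⟨ cong (c *_) (sum-interval x k⊆a) ⟩
  c * suc x ^ ∣ a ─ k ∣ ∎)
  where
  open ≤-Reasoning
  I = interval k a

ContainsSunflower-mono : ∀ {N r} {F G : List (Subset N)} → G ⊆ₗ F →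
                         ContainsSunflower r G → ContainsSunflower r F
ContainsSunflower-mono G⊆F (S , S∈G , isSunflower) = S , G⊆F ∘ S∈G , isSunflower

kernel⇒IsSunflower : ∀ {N r} {k : Subset N} (S : Fin r → Subset N) → (∀ i → k ⊆ S i) → (∀ i → S i ≢ k) →
                     (∀ {i j} → i ≢ j → S i ∩ S j ≡ k) → IsSunflower r S
kernel⇒IsSunflower {k = k} S k⊆S S≢k S∩S≡k = injective , λ i j i≢j → trans (S∩S≡k i≢j) (k≡⋂ i≢j)
  where
  injective : ∀ {i j} → S i ≡ S j → i ≡ j
  injective {i} {j} Si≡Sj with i ≟ᶠ j
  ... | yes i≡j = i≡j
  ... | no  i≢j = contradiction (trans (sym (∩-idem (S i))) (trans (cong (S i ∩_) Si≡Sj) (S∩S≡k i≢j))) (S≢k i)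
  k⊆⋂ : k ⊆ ⋂ (tabulate S)
  k⊆⋂ = ⊆-⋂ (tabulate S) λ q∈S → case ∈-tabulate⁻ q∈S of λ { (i , refl) → k⊆S i }
  k≡⋂ : ∀ {i j} → i ≢ j → k ≡ ⋂ (tabulate S)
  k≡⋂ {i} {j} i≢j = ⊆-antisym k⊆⋂
    (subst (⋂ (tabulate S) ⊆_) (S∩S≡k i≢j) (⊆-∩ (⋂-⊆ (∈-tabulate⁺ i)) (⋂-⊆ (∈-tabulate⁺ j))))

AllPairs-lookup : ∀ {A : Set} {R : A → A → Set} → Symmetric R → ∀ {xs} → AllPairs R xs →
                  ∀ {i j} → i ≢ j → R (lookup xs i) (lookup xs j)
AllPairs-lookup R-sym (_ ∷ _)  {zero}  {zero}  i≢j = contradiction refl i≢j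
AllPairs-lookup R-sym (r ∷ _)  {zero}  {suc j} _   = All.lookup r (∈-lookup j)
AllPairs-lookup R-sym (r ∷ _)  {suc i} {zero}  _   = R-sym (All.lookup r (∈-lookup i))
AllPairs-lookup R-sym (_ ∷ rs) {suc i} {suc j} i≢j = AllPairs-lookup R-sym rs (i≢j ∘ cong suc)

kernel⇒ContainsSunflower : ∀ {N r} {k : Subset N} {D} → r ≤ length D → (∀ {a} → a ∈ D → k ⊆ a × a ≢ k) →
                           AllPairs (λ a b → a ∩ b ≡ k) D → ContainsSunflower r D
kernel⇒ContainsSunflower {D = D} r≤∣D∣ petal pairwise =
  S , (λ i → ∈-lookup _) ,
  kernel⇒IsSunflower S (proj₁ ∘ petal ∘ S∈D) (proj₂ ∘ petal ∘ S∈D)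
    (λ {i} {j} i≢j → AllPairs-lookup (λ {a} {b} a∩b≡k → trans (∩-comm b a) a∩b≡k) pairwise
                       (i≢j ∘ inject≤-injective r≤∣D∣ r≤∣D∣ i j))
  where
  S = λ i → lookup D (inject≤ i r≤∣D∣)
  S∈D = λ i → ∈-lookup {xs = D} (inject≤ i r≤∣D∣)

module _ {N} (k : Subset N) where

  petals : List (Subset N) → List (Subset N)
  petals []      = []
  petals (b ∷ F) with all? (λ a → b ∩ a ≟ˢ k) (petals F)
  ... | yes _ = b ∷ petals F
  ... | no  _ = petals F

  petals-⊆ : ∀ F → petals F ⊆ₗ F
  petals-⊆ (b ∷ F) with all? (λ a → b ∩ a ≟ˢ k) (petals F)
  ... | yes _ = λ { (here refl) → here refl ; (there a∈) → there (petals-⊆ F a∈) }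
  ... | no  _ = there ∘ petals-⊆ F

  petals-pairwise : ∀ F → AllPairs (λ a b → a ∩ b ≡ k) (petals F)
  petals-pairwise []      = []
  petals-pairwise (b ∷ F) with all? (λ a → b ∩ a ≟ˢ k) (petals F)
  ... | yes b∩petals≡k = b∩petals≡k ∷ petals-pairwise F
  ... | no  _          = petals-pairwise F

  petals-cover : ∀ F {b} → b ∈ F → b ≢ k → Any (λ a → b ∩ a ≢ k) (petals F)
  petals-cover (b ∷ F) (here refl) b≢k with all? (λ a → b ∩ a ≟ˢ k) (petals F)
  ... | yes _    = here (b≢k ∘ trans (sym (∩-idem b)))
  ... | no ¬all = ¬All⇒Any¬ (λ a → b ∩ a ≟ˢ k) (petals F) ¬all
  petals-cover (c ∷ F) (there b∈F) b≢k with all? (λ a → c ∩ a ≟ˢ k) (petals F)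
  ... | yes _ = there (petals-cover F b∈F b≢k)
  ... | no  _ = petals-cover F b∈F b≢k

UniformOver : ∀ {N} → Subset N → ℕ → List (Subset N) → Set
UniformOver k d F = ∀ {b} → b ∈ F → k ⊆ b × ∣ b ─ k ∣ ≡ d

module _ {N} {F : List (Subset N)} {a : Subset N} (a∈F : a ∈ F) where

  traces-UniformOver : ∀ {k d t G} → UniformOver k d F → G ⊆ₗ F →
                       UniformOver t ∣ a ─ t ∣ (filter (λ b → b ∩ a ≟ˢ t) G)
  traces-UniformOver {t = t} unif G⊆F b∈ with b∈G , refl ← ∈-filter⁻ (λ b → b ∩ a ≟ˢ t) b∈ =
    let k⊆a , ∣a─k∣≡d = unif a∈F
        k⊆b , ∣b─k∣≡d = unif (G⊆F b∈G)
    in p∩q⊆p _ a , ∣b─b∩a∣≡∣a─b∩a∣ k⊆a k⊆b (trans ∣a─k∣≡d (sym ∣b─k∣≡d))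

  trace-size∈ : ∀ {L b t} → LIntersecting L F → b ∈ F → b ∩ a ≡ t → b ≢ t → ∣ t ∣ ∈ L
  trace-size∈ li b∈F refl b≢t = li _ a b∈F a∈F λ { refl → b≢t (sym (∩-idem a)) }

LIntersecting-mono : ∀ {N L} {F G : List (Subset N)} → G ⊆ₗ F → LIntersecting L F → LIntersecting L G
LIntersecting-mono G⊆F li b b′ b∈ b′∈ = li b b′ (G⊆F b∈) (G⊆F b′∈)

LIntersecting-above : ∀ {N L} {G : List (Subset N)} {t c} → LIntersecting L G → (∀ {b} → b ∈ G → t ⊆ b) →
                      c < ∣ t ∣ → LIntersecting (filter (c <?_) L) G
LIntersecting-above {t = t} li t⊆G c<∣t∣ b b′ b∈ b′∈ b≢b′ =
  ∈-filter⁺ (_ <?_) (li b b′ b∈ b′∈ b≢b′) (<-≤-trans c<∣t∣ (p⊆q⇒∣p∣≤∣q∣ (⊆-∩ (t⊆G b∈) (t⊆G b′∈))))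

p*[m^a*[1+a]^e]≤m^s*s^e : ∀ m .{{_ : NonZero m}} {p a s} e → p ≤ m → a < s →
                          p * (m ^ a * suc a ^ e) ≤ m ^ s * s ^ e
p*[m^a*[1+a]^e]≤m^s*s^e m {p} {a} {s} e p≤m a<s = begin
  p * (m ^ a * suc a ^ e) ≤⟨ *-monoˡ-≤ _ p≤m ⟩
  m * (m ^ a * suc a ^ e) ≡⟨ *-assoc m _ _ ⟨
  m ^ suc a * suc a ^ e   ≤⟨ *-mono-≤ (^-monoʳ-≤ m a<s) (^-monoˡ-≤ e a<s) ⟩
  m ^ s * s ^ e           ∎
  where open ≤-Reasoning

module _ {N : ℕ} (r m : ℕ) .{{_ : NonZero m}} (r≤1+m : r ≤ suc m) where

  ExcessBound : ℕ → Set
  ExcessBound d = ∀ {k L} {F : List (Subset N)} → Unique F → UniformOver k d F → LIntersecting L F →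
                  (∀ {b} → b ∈ F → b ≢ k → ∣ k ∣ ∈ L) →
                  ContainsSunflower r F ⊎ length F ≤ m ^ length L * length L ^ d

  module _ {d k L} {F : List (Subset N)}
           (uF : Unique F) (unif : UniformOver k (suc d) F) (li : LIntersecting L F)
           {a} (a∈F : a ∈ F) where

    private
      L′ = filter (∣ k ∣ <?_) L
      Fₐ = filter (λ b → ¬? (b ∩ a ≟ˢ k)) F
      k⊆a = proj₁ (unif a∈F)

    petal-trace-bound : (∀ {e} → e < suc d → ExcessBound e) → ∀ {t} → k ⊆ t → t ⊆ a →
                        ContainsSunflower r F ⊎
                        length (filter (λ b → b ∩ a ≟ˢ t) Fₐ) ≤ m ^ length L′ * length L′ ^ ∣ a ─ t ∣
    petal-trace-bound _ {t} _ _ with t ≟ˢ k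
    petal-trace-bound _ _ _ | yes refl =
      inj₂ (subst (_≤ _) (sym (cong length (filter-none (λ b → b ∩ a ≟ˢ k) {Fₐ}
        (All.tabulate (proj₂ ∘ ∈-filter⁻ (λ b → ¬? (b ∩ a ≟ˢ k)) {xs = F}))))) z≤n)
    petal-trace-bound excess-bound′ {t} k⊆t t⊆a | no t≢k =
      map₁ (ContainsSunflower-mono G⊆F)
        (excess-bound′ ∣a─t∣<1+d (Unique-filter⁺ _ {Fₐ} (Unique-filter⁺ _ {F} uF)) unifₜ
          (LIntersecting-above (LIntersecting-mono G⊆F li) (λ b∈ → proj₁ (unifₜ b∈)) ∣k∣<∣t∣)
          (λ b∈ b≢t → ∈-filter⁺ (∣ k ∣ <?_) (trace-size∈ a∈F li (G⊆F b∈) (trace≡t b∈) b≢t) ∣k∣<∣t∣))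
      where
      trace≡t : ∀ {b} → b ∈ filter (λ b → b ∩ a ≟ˢ t) Fₐ → b ∩ a ≡ t
      trace≡t = proj₂ ∘ ∈-filter⁻ (λ b → b ∩ a ≟ˢ t) {xs = Fₐ}
      G⊆F : filter (λ b → b ∩ a ≟ˢ t) Fₐ ⊆ₗ F
      G⊆F = filter-⊆ _ F ∘ filter-⊆ _ Fₐ
      unifₜ : UniformOver t ∣ a ─ t ∣ (filter (λ b → b ∩ a ≟ˢ t) Fₐ)
      unifₜ = traces-UniformOver a∈F unif (filter-⊆ _ F)
      ∣k∣<∣t∣ = q⊂p⇒∣q∣<∣p∣ k⊆t t≢k
      ∣a─t∣<1+d : ∣ a ─ t ∣ < suc d
      ∣a─t∣<1+d = begin-strict
        ∣ a ─ t ∣             <⟨ m<m+n _ (n≢0⇒n>0 (t≢k ∘ ∣p─q∣≡0⇒p≡q k⊆t)) ⟩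
        ∣ a ─ t ∣ + ∣ t ─ k ∣ ≡⟨ ∣p─q∣≡∣p─r∣+∣r─q∣ k⊆t t⊆a ⟨
        ∣ a ─ k ∣             ≡⟨ proj₂ (unif a∈F) ⟩
        suc d                 ∎
        where open ≤-Reasoning

    petal-bound : (∀ {e} → e < suc d → ExcessBound e) →
                  ContainsSunflower r F ⊎ length Fₐ ≤ m ^ length L′ * suc (length L′) ^ suc d
    petal-bound excess-bound′ =
      subst (λ e → ContainsSunflower r F ⊎ length Fₐ ≤ m ^ length L′ * suc (length L′) ^ e) (proj₂ (unif a∈F))
      (length-bound-by-traces (m ^ length L′) (length L′) k⊆a Fₐ (λ b∈ → proj₁ (unif (filter-⊆ _ F b∈)))
        (petal-trace-bound excess-bound′))

  excess-bound : ∀ d → Acc _<_ d → ExcessBound d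
  excess-bound zero _ {L = L} {F} uF unif _ _ = inj₂ (begin
    length F         ≤⟨ Unique-const⇒length≤1 uF (λ b∈F → uncurry ∣p─q∣≡0⇒p≡q (unif b∈F)) ⟩
    1                ≤⟨ m^n>0 m (length L) ⟩
    m ^ length L     ≡⟨ *-identityʳ _ ⟨
    m ^ length L * 1 ∎)
    where open ≤-Reasoning
  excess-bound (suc d) _ {F = []} _ _ _ _ = inj₂ z≤n
  excess-bound (suc d) (acc smaller) {k} {L} {F@(_ ∷ _)} uF unif li k∈L = bound
    where
    D = petals k F
    ℓ = length (filter (∣ k ∣ <?_) L)

    ≢k : ∀ {b} → b ∈ F → b ≢ k
    ≢k b∈F refl = 0≢1+n (trans (sym (∣p─p∣≡0 k)) (proj₂ (unif b∈F)))

    ℓ<∣L∣ : ℓ < length L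
    ℓ<∣L∣ = filter-notAll (∣ k ∣ <?_) L
            (Any.map (λ { refl → <-irrefl refl }) (k∈L (here refl) (≢k (here refl))))

    bound : ContainsSunflower r F ⊎ length F ≤ m ^ length L * length L ^ suc d
    bound with r ≤? length D
    ... | yes r≤∣D∣ = inj₁ (ContainsSunflower-mono (petals-⊆ k F)
            (kernel⇒ContainsSunflower r≤∣D∣ (λ a∈D → proj₁ (unif (petals-⊆ k F a∈D)) , ≢k (petals-⊆ k F a∈D))
                                       (petals-pairwise k F)))
    ... | no r≰∣D∣ with sequence-⊎ D (λ a∈D →
                          petal-bound uF unif li (petals-⊆ k F a∈D) (λ e<1+d → excess-bound _ (smaller e<1+d)))
    ...   | inj₁ sunflower = inj₁ sunflower
    ...   | inj₂ bounds    = inj₂ (begin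
      length F
        ≤⟨ length≤sum-length-filter (λ a b → ¬? (b ∩ a ≟ˢ k)) D F (λ b∈F → petals-cover k F b∈F (≢k b∈F)) ⟩
      sum (map (λ a → length (filter (λ b → ¬? (b ∩ a ≟ˢ k)) F)) D)
        ≤⟨ sum-map-mono D bounds ⟩
      sum (map (λ _ → m ^ ℓ * suc ℓ ^ suc d) D)
        ≡⟨ sum-map-const _ D ⟩
      length D * (m ^ ℓ * suc ℓ ^ suc d)
        ≤⟨ p*[m^a*[1+a]^e]≤m^s*s^e m (suc d) (≤-pred (≤-trans (≰⇒> r≰∣D∣) r≤1+m)) ℓ<∣L∣ ⟩
      m ^ length L * length L ^ suc d ∎)
      where open ≤-Reasoning

  star-bound : ∀ {n L} {F : List (Subset N)} {a} → Unique F → Uniform n F → LIntersecting L F → a ∈ F →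
               ContainsSunflower r F ⊎ length F ≤ sizeBound n (length L) m
  star-bound {n} {L} {F} {a} uF unif li a∈F =
    map₂ (λ ∣F∣≤ → ≤-trans ∣F∣≤ (≤-reflexive bound≡sizeBound))
      (length-bound-by-traces (m ^ s) s (⊆-min a) F (λ {b} _ → ⊆-min b) trace-bound)
    where
    s = length L

    unif⊥ : UniformOver ⊥ n F
    unif⊥ {b} b∈F = ⊆-min b , trans (cong ∣_∣ (p─⊥≡p b)) (unif b b∈F)

    trace-bound : ∀ {t} → ⊥ ⊆ t → t ⊆ a →
                  ContainsSunflower r F ⊎
                  length (filter (λ b → b ∩ a ≟ˢ t) F) ≤ m ^ s * s ^ ∣ a ─ t ∣
    trace-bound {t} _ _ = map₁ (ContainsSunflower-mono (filter-⊆ _ F))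
      (excess-bound _ (<-wellFounded _) (Unique-filter⁺ _ uF) (traces-UniformOver a∈F unif⊥ (λ b∈ → b∈))
        (LIntersecting-mono (filter-⊆ _ F) li)
        (λ b∈ b≢t → trace-size∈ a∈F li (filter-⊆ _ F b∈) (proj₂ (∈-filter⁻ (λ b → b ∩ a ≟ˢ t) {xs = F} b∈))
                                b≢t))

    bound≡sizeBound : m ^ s * suc s ^ ∣ a ─ ⊥ ∣ ≡ sizeBound n s m
    bound≡sizeBound = begin
      m ^ s * suc s ^ ∣ a ─ ⊥ ∣ ≡⟨ cong (λ e → m ^ s * suc s ^ e) (proj₂ (unif⊥ a∈F)) ⟩
      m ^ s * suc s ^ n         ≡⟨ *-comm (m ^ s) _ ⟩
      suc s ^ n * m ^ s         ≡⟨ cong (λ x → x ^ n * m ^ s) (+-comm 1 s) ⟩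
      (s + 1) ^ n * m ^ s       ∎
      where open ≡-Reasoning

mBound-nonZero : ∀ n r → NonZero (mBound n r)
mBound-nonZero n r = >-nonZero (≤-trans (m≤n+m 1 (n * n ∸ n)) (m≤n⊔m (r ∸ 1) _))

r≤1+mBound : ∀ n r → r ≤ suc (mBound n r)
r≤1+mBound n zero    = z≤n
r≤1+mBound n (suc r) = s≤s (m≤m⊔n r _)

theorem1p4 : (N n r : ℕ) → 1 ≤ n → 1 ≤ r →
    (L : List ℕ) → Unique L → 1 ≤ length L →
    (F : List (Subset N)) → Unique F →
    LIntersecting L F → Uniform n F →
    sizeBound n (length L) (mBound n r) < length F →
    ContainsSunflower r F
theorem1p4 N n r _ _ L _ _ []      _  _  _    ()
theorem1p4 N n r _ _ L _ _ F@(_ ∷ _) uF li unif big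
  with star-bound r (mBound n r) {{mBound-nonZero n r}} (r≤1+mBound n r) uF unif li (here refl)
... | inj₁ sunflower = sunflower
... | inj₂ ∣F∣≤      = contradiction ∣F∣≤ (<⇒≱ big)
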